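{- Let $\langle A,\land_B,\rightarrowtail,0\rangle$ be a Brignole algebra and define $x\land y:=x\land_B y$, $x\lor y:=((x\rightarrowtail 0)\land_B(y\rightarrowtail 0))\rightarrowtail 0$, $x\to y:=x\rightarrowtail(x\rightarrowtail y)$, $\sim x:=x\rightarrowtail 0$, $1:=0\rightarrowtail 0$. Then for all $x,y,z\in A$: (a) $x\land(x\lor y)=x$, $x\land(y\lor z)=(z\land x)\lor(y\land x)$, and $(x\land\sim x)\land(y\lor\sim y)=x\land\sim x$; (b) $\sim 1=0$; (c) $1=1\rightarrowtail 1$; (d) $1\rightarrowtail x=x$; (e) $\sim\sim x=x$; (f) $\sim(x\lor y)=\sim x\land\sim y$; (g) $\sim(x\land y)=\sim x\lor\sim y$; (h) $x\land(x\to y)=x\land(\sim x\lor y)$; (i) $x\lor 1=1$; (j) $x\rightarrowtail 1=1$; (k) $(x\land y)\to z=x\to(y\to z)$; (l) $x\rightarrowtail x=1$, and in particular $x\rightarrowtail x=y\rightarrowtail y$; (m) $x\to x=1$.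
   Context: A Brignole algebra is an algebra $\langle A,\land_B,\rightarrowtail,0\rangle$ of type $(2,2,0)$ such that, with $\sim_B x:=x\rightarrowtail 0$ and $x\lor_B y:=((x\rightarrowtail 0)\land_B(y\rightarrowtail 0))\rightarrowtail 0$, for all $x,y,z$: (B1) $(x\rightarrowtail x)\rightarrowtail y=y$; (B2) $(x\rightarrowtail y)\land_B y=y$; (B3) $x\land_B\sim_B(x\land_B\sim_B y)=x\land_B(x\rightarrowtail y)$; (B4) $x\rightarrowtail(y\land_B z)=(x\rightarrowtail y)\land_B(x\rightarrowtail z)$; (B5) $x\rightarrowtail y=\sim_B y\rightarrowtail\sim_B x$; (B6) $x\rightarrowtail(x\rightarrowtail(y\rightarrowtail(y\rightarrowtail z)))=(x\land_B y)\rightarrowtail((x\land_B y)\rightarrowtail z)$; (B7) $\sim_B(\sim_B x\land_B y)\rightarrowtail(x\rightarrowtail y)=x\rightarrowtail y$; (B8) $x\land_B(x\lor_B y)=x$; (B9) $x\land_B(y\lor_B z)=(z\land_B x)\lor_B(y\land_B x)$; (B10) $(x\land_B\sim_B x)\land_B(y\lor_B\sim_B y)=x\land_B\sim_B x$. -}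

module Defs where

open import Level using (Level; suc)
open import Relation.Binary.PropositionalEquality using (_≡_)

record BrignoleAlgebra (a : Level) : Set (suc a) where
  infixr 7 _∧B_
  infixr 5 _↣_
  field
    Carrier : Set a
    _∧B_    : Carrier → Carrier → Carrier
    _↣_     : Carrier → Carrier → Carrier
    𝟎       : Carrier

  infix 9 ∼B_
  infixr 6 _∨B_
  ∼B_ : Carrier → Carrier
  ∼B x = x ↣ 𝟎

  _∨B_ : Carrier → Carrier → Carrier
  x ∨B y = ((x ↣ 𝟎) ∧B (y ↣ 𝟎)) ↣ 𝟎

  field
    B1  : ∀ x y → (x ↣ x) ↣ y ≡ y
    B2  : ∀ x y → (x ↣ y) ∧B y ≡ y
    B3  : ∀ x y → x ∧B ∼B (x ∧B ∼B y) ≡ x ∧B (x ↣ y)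
    B4  : ∀ x y z → x ↣ (y ∧B z) ≡ (x ↣ y) ∧B (x ↣ z)
    B5  : ∀ x y → x ↣ y ≡ ∼B y ↣ ∼B x
    B6  : ∀ x y z → x ↣ (x ↣ (y ↣ (y ↣ z))) ≡ (x ∧B y) ↣ ((x ∧B y) ↣ z)
    B7  : ∀ x y → ∼B (∼B x ∧B y) ↣ (x ↣ y) ≡ x ↣ y
    B8  : ∀ x y → x ∧B (x ∨B y) ≡ x
    B9  : ∀ x y z → x ∧B (y ∨B z) ≡ (z ∧B x) ∨B (y ∧B x)
    B10 : ∀ x y → (x ∧B ∼B x) ∧B (y ∨B ∼B y) ≡ x ∧B ∼B x

  infixr 7 _∧_
  infixr 6 _∨_
  infixr 5 _⇒_
  infix 9 ∼_
  _∧_ : Carrier → Carrier → Carrier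
  x ∧ y = x ∧B y

  _∨_ : Carrier → Carrier → Carrier
  x ∨ y = ((x ↣ 𝟎) ∧B (y ↣ 𝟎)) ↣ 𝟎

  _⇒_ : Carrier → Carrier → Carrier
  x ⇒ y = x ↣ (x ↣ y)

  ∼_ : Carrier → Carrier
  ∼ x = x ↣ 𝟎

  𝟏 : Carrier
  𝟏 = 𝟎 ↣ 𝟎

module _ {a : Level} (A : BrignoleAlgebra a) where
  open BrignoleAlgebra A
  open import Data.Product using (_×_)

  Theorem7 : Set a
  Theorem7 = ∀ x y z →
      ((x ∧ (x ∨ y) ≡ x) × (x ∧ (y ∨ z) ≡ (z ∧ x) ∨ (y ∧ x))
        × ((x ∧ ∼ x) ∧ (y ∨ ∼ y) ≡ x ∧ ∼ x))
    × (∼ 𝟏 ≡ 𝟎)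
    × (𝟏 ≡ 𝟏 ↣ 𝟏)
    × (𝟏 ↣ x ≡ x)
    × (∼ ∼ x ≡ x)
    × (∼ (x ∨ y) ≡ ∼ x ∧ ∼ y)
    × (∼ (x ∧ y) ≡ ∼ x ∨ ∼ y)
    × (x ∧ (x ⇒ y) ≡ x ∧ (∼ x ∨ y))
    × (x ∨ 𝟏 ≡ 𝟏)
    × (x ↣ 𝟏 ≡ 𝟏)
    × ((x ∧ y) ⇒ z ≡ x ⇒ (y ⇒ z))
    × ((x ↣ x ≡ 𝟏) × (x ↣ x ≡ y ↣ y))
    × (x ⇒ x ≡ 𝟏)

{-# OPTIONS --safe #-}
-- B1 makes 𝟏 a left unit of ↣, and B5 then gives x ↣ x = 𝟏 and ∼ ∼ x = x.
-- With these, B8 and B9 make ∧ a commutative meet with top 𝟏 and bottom 𝟎,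
-- whose De Morgan dual is ∨, so x ≤ y := x ∧ y = x is a lattice order.
-- For (h), B3 reads x ∧ (x ↣ y) = x ∧ (∼ x ∨ y) after De Morgan; applying it
-- twice (the inner ↣ is absorbed using B4) leaves x ∧ (∼ x ∨ Q) with
-- Q = x ∧ (∼ x ∨ y), which distributes to Q ∨ (x ∧ ∼ x) = Q because x ∧ ∼ x ≤ Q.
module Submission where

open import Defs
open import Level using (Level)
open import Data.Product using (_,_)
open import Relation.Binary.PropositionalEquality

module BrignoleProperties {a : Level} (A : BrignoleAlgebra a) where
  open BrignoleAlgebra A
  open ≡-Reasoning

  ↣-identityˡ : ∀ x → 𝟏 ↣ x ≡ x
  ↣-identityˡ = B1 𝟎

  ∼𝟏≡𝟎 : ∼ 𝟏 ≡ 𝟎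
  ∼𝟏≡𝟎 = ↣-identityˡ 𝟎

  ∼-involutive : ∀ x → ∼ ∼ x ≡ x
  ∼-involutive x = begin
    ∼ ∼ x      ≡⟨ cong (∼ x ↣_) ∼𝟏≡𝟎 ⟨
    ∼ x ↣ ∼ 𝟏  ≡⟨ B5 𝟏 x ⟨
    𝟏 ↣ x      ≡⟨ ↣-identityˡ x ⟩
    x          ∎

  ↣-self : ∀ x → x ↣ x ≡ 𝟏
  ↣-self x = begin
    x ↣ x              ≡⟨ ↣-identityˡ (x ↣ x) ⟨
    𝟏 ↣ (x ↣ x)        ≡⟨ B5 𝟏 (x ↣ x) ⟩
    ∼ (x ↣ x) ↣ ∼ 𝟏    ≡⟨ cong₂ _↣_ (B1 x 𝟎) ∼𝟏≡𝟎 ⟩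
    𝟏                  ∎

  ∨-zeroʳ : ∀ x → x ∨ 𝟏 ≡ 𝟏
  ∨-zeroʳ x = trans (cong (λ t → ∼ (∼ x ∧ t)) ∼𝟏≡𝟎) (cong ∼_ (B2 x 𝟎))

  ∧-identityʳ : ∀ x → x ∧ 𝟏 ≡ x
  ∧-identityʳ x = trans (cong (x ∧_) (sym (∨-zeroʳ x))) (B8 x 𝟏)

  ∧-identityˡ : ∀ x → 𝟏 ∧ x ≡ x
  ∧-identityˡ x = trans (cong (_∧ x) (sym (↣-self x))) (B2 x x)

  ↣-zeroʳ : ∀ x → x ↣ 𝟏 ≡ 𝟏
  ↣-zeroʳ x = trans (sym (∧-identityʳ (x ↣ 𝟏))) (B2 x 𝟏)

  ∧-zeroʳ : ∀ x → x ∧ 𝟎 ≡ 𝟎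
  ∧-zeroʳ x = trans (cong (_∧ 𝟎) (sym (∼-involutive x))) (B2 (∼ x) 𝟎)

  ∨-identityʳ : ∀ x → x ∨ 𝟎 ≡ x
  ∨-identityʳ x = trans (cong ∼_ (∧-identityʳ (∼ x))) (∼-involutive x)

  ∨-identityˡ : ∀ x → 𝟎 ∨ x ≡ x
  ∨-identityˡ x = trans (cong ∼_ (∧-identityˡ (∼ x))) (∼-involutive x)

  ∧-zeroˡ : ∀ x → 𝟎 ∧ x ≡ 𝟎
  ∧-zeroˡ x = begin
    𝟎 ∧ x                ≡⟨ cong (𝟎 ∧_) (∨-identityʳ x) ⟨
    𝟎 ∧ (x ∨ 𝟎)          ≡⟨ B9 𝟎 x 𝟎 ⟩
    (𝟎 ∧ 𝟎) ∨ (x ∧ 𝟎)    ≡⟨ cong₂ _∨_ (∧-zeroʳ 𝟎) (∧-zeroʳ x) ⟩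
    𝟎 ∨ 𝟎                ≡⟨ ∨-identityʳ 𝟎 ⟩
    𝟎                    ∎

  ∧-comm : ∀ x y → x ∧ y ≡ y ∧ x
  ∧-comm x y = begin
    x ∧ y                ≡⟨ cong (x ∧_) (∨-identityʳ y) ⟨
    x ∧ (y ∨ 𝟎)          ≡⟨ B9 x y 𝟎 ⟩
    (𝟎 ∧ x) ∨ (y ∧ x)    ≡⟨ cong (_∨ (y ∧ x)) (∧-zeroˡ x) ⟩
    𝟎 ∨ (y ∧ x)          ≡⟨ ∨-identityˡ (y ∧ x) ⟩
    y ∧ x                ∎

  ∨-comm : ∀ x y → x ∨ y ≡ y ∨ x
  ∨-comm x y = cong ∼_ (∧-comm (∼ x) (∼ y))

  ∼-∧ : ∀ x y → ∼ (x ∧ y) ≡ ∼ x ∨ ∼ y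
  ∼-∧ x y = sym (cong₂ (λ u v → ∼ (u ∧ v)) (∼-involutive x) (∼-involutive y))

  ∼-∨ : ∀ x y → ∼ (x ∨ y) ≡ ∼ x ∧ ∼ y
  ∼-∨ x y = ∼-involutive (∼ x ∧ ∼ y)

  ∨-absorbs-∧ : ∀ x y → x ∨ (x ∧ y) ≡ x
  ∨-absorbs-∧ x y = begin
    ∼ (∼ x ∧ ∼ (x ∧ y))   ≡⟨ cong (λ t → ∼ (∼ x ∧ t)) (∼-∧ x y) ⟩
    ∼ (∼ x ∧ (∼ x ∨ ∼ y)) ≡⟨ cong ∼_ (B8 (∼ x) (∼ y)) ⟩
    ∼ ∼ x                 ≡⟨ ∼-involutive x ⟩
    x                     ∎

  ∧-↣ : ∀ x y → x ∧ (x ↣ y) ≡ x ∧ (∼ x ∨ y)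
  ∧-↣ x y = begin
    x ∧ (x ↣ y)         ≡⟨ B3 x y ⟨
    x ∧ ∼ (x ∧ ∼ y)     ≡⟨ cong (x ∧_) (∼-∧ x (∼ y)) ⟩
    x ∧ (∼ x ∨ ∼ ∼ y)   ≡⟨ cong (λ t → x ∧ (∼ x ∨ t)) (∼-involutive y) ⟩
    x ∧ (∼ x ∨ y)       ∎

  infix 4 _≤_
  _≤_ : Carrier → Carrier → Set a
  x ≤ y = x ∧ y ≡ x

  ≤⇒∨-absorbs : ∀ {x y} → y ≤ x → x ∨ y ≡ x
  ≤⇒∨-absorbs {x} {y} y≤x =
    trans (cong (x ∨_) (sym (trans (∧-comm x y) y≤x))) (∨-absorbs-∧ x y)

  x∧y≤x : ∀ x y → x ∧ y ≤ x
  x∧y≤x x y = begin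
    (x ∧ y) ∧ x               ≡⟨ cong ((x ∧ y) ∧_) x∧y∨x≡x ⟨
    (x ∧ y) ∧ ((x ∧ y) ∨ x)   ≡⟨ B8 (x ∧ y) x ⟩
    x ∧ y                     ∎
    where
    x∧y∨x≡x : (x ∧ y) ∨ x ≡ x
    x∧y∨x≡x = trans (∨-comm (x ∧ y) x) (∨-absorbs-∧ x y)

  x∧y≤y : ∀ x y → x ∧ y ≤ y
  x∧y≤y x y = begin
    (x ∧ y) ∧ y   ≡⟨ cong₂ _∧_ (∧-comm x y) refl ⟩
    (y ∧ x) ∧ y   ≡⟨ x∧y≤x y x ⟩
    y ∧ x         ≡⟨ ∧-comm y x ⟩
    x ∧ y         ∎

  ≤-trans : ∀ {x y z} → x ≤ y → y ≤ z → x ≤ z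
  ≤-trans {x} {y} {z} x≤y y≤z = begin
    x ∧ z                ≡⟨ cong (x ∧_) (≤⇒∨-absorbs y≤z) ⟨
    x ∧ (z ∨ y)          ≡⟨ B9 x z y ⟩
    (y ∧ x) ∨ (z ∧ x)    ≡⟨ cong₂ _∨_ (trans (∧-comm y x) x≤y) (∧-comm z x) ⟩
    x ∨ (x ∧ z)          ≡⟨ ∨-absorbs-∧ x z ⟩
    x                    ∎

  ∧-greatest : ∀ {x y z} → x ≤ y → x ≤ z → x ≤ y ∧ z
  ∧-greatest {x} {y} {z} x≤y x≤z = begin
    x ∧ (y ∧ z)             ≡⟨ cong (λ t → x ∧ (y ∧ t)) (≤⇒∨-absorbs x≤z) ⟨
    x ∧ (y ∧ (z ∨ x))       ≡⟨ cong (x ∧_) (B9 y z x) ⟩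
    x ∧ ((x ∧ y) ∨ (z ∧ y)) ≡⟨ cong (λ t → x ∧ (t ∨ (z ∧ y))) x≤y ⟩
    x ∧ (x ∨ (z ∧ y))       ≡⟨ B8 x (z ∧ y) ⟩
    x                       ∎

  ∧-⇒ : ∀ x y → x ∧ (x ⇒ y) ≡ x ∧ (∼ x ∨ y)
  ∧-⇒ x y = begin
    x ∧ (x ↣ (x ↣ y))        ≡⟨ cong (x ∧_) ↣-absorbs-∧ ⟨
    x ∧ (x ↣ P)              ≡⟨ ∧-↣ x P ⟩
    x ∧ (∼ x ∨ P)            ≡⟨ cong (λ t → x ∧ (∼ x ∨ t)) (∧-↣ x y) ⟩
    x ∧ (∼ x ∨ Q)            ≡⟨ B9 x (∼ x) Q ⟩
    (Q ∧ x) ∨ (∼ x ∧ x)      ≡⟨ cong₂ _∨_ (x∧y≤x x (∼ x ∨ y)) (∧-comm (∼ x) x) ⟩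
    Q ∨ (x ∧ ∼ x)            ≡⟨ ≤⇒∨-absorbs x∧∼x≤Q ⟩
    Q                        ∎
    where
    P = x ∧ (x ↣ y)
    Q = x ∧ (∼ x ∨ y)
    ↣-absorbs-∧ : x ↣ P ≡ x ↣ (x ↣ y)
    ↣-absorbs-∧ = begin
      x ↣ (x ∧ (x ↣ y))           ≡⟨ B4 x x (x ↣ y) ⟩
      (x ↣ x) ∧ (x ↣ (x ↣ y))     ≡⟨ cong (_∧ (x ↣ (x ↣ y))) (↣-self x) ⟩
      𝟏 ∧ (x ↣ (x ↣ y))           ≡⟨ ∧-identityˡ _ ⟩
      x ↣ (x ↣ y)                 ∎
    x∧∼x≤Q : x ∧ ∼ x ≤ Q
    x∧∼x≤Q = ∧-greatest (x∧y≤x x (∼ x)) (≤-trans (x∧y≤y x (∼ x)) (B8 (∼ x) y))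

mainTheorem7 : ∀ {a : Level} (A : BrignoleAlgebra a) → Theorem7 A
mainTheorem7 A x y z =
    (B8 x y , B9 x y z , B10 x y)
  , ∼𝟏≡𝟎
  , sym (↣-identityˡ 𝟏)
  , ↣-identityˡ x
  , ∼-involutive x
  , ∼-∨ x y
  , ∼-∧ x y
  , ∧-⇒ x y
  , ∨-zeroʳ x
  , ↣-zeroʳ x
  , sym (B6 x y z)
  , (↣-self x , trans (↣-self x) (sym (↣-self y)))
  , trans (cong (x ↣_) (↣-self x)) (↣-zeroʳ x)
  where
  open BrignoleAlgebra A
  open BrignoleProperties A
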